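{- Let $n$ be a positive integer, $k=\lceil\log_3 n\rceil$, and let $m$ be an integer with $n\le m<3^k<3n$. Suppose that $m=\delta p$, where $\delta\ge 39$ is an integer, $p\ge 5$ is a prime, $p\ne 7$ and $p\nmid\delta$. Then there exist integers $1\le a<b\le n$ such that $b^3+b\equiv a^3+a\pmod{m}$.
   Context: $\lceil x\rceil$ denotes the smallest integer no less than $x$. -}

module Defs where

open import Data.Nat using (ℕ; zero; suc; _≤_; _<_; _^_; _∸_)
open import Data.Product using (_×_)
open import Data.Integer using (ℤ; +_; _-_)
open import Data.Integer.Divisibility using (_∣_)

-- k = ⌈log₃ n⌉ : the smallest natural number k with n ≤ 3^k
-- (for n ≥ 1 this is the usual ceiling of the base-3 logarithm).
IsCeilLog3 : ℕ → ℕ → Set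
IsCeilLog3 n k = (n ≤ 3 ^ k) × (∀ j → n ≤ 3 ^ j → k ≤ j)

_≡_[mod_] : ℕ → ℕ → ℕ → Set
x ≡ y [mod m ] = (+ m) ∣ ((+ x) - (+ y))

{-# OPTIONS --safe #-}
-- With b = a + d one has b³ + b − (a³ + a) = d (3a² + 3ad + d² + 1). Take d = δt with
-- 1 ≤ t ≤ T = ⌊12p/39⌋: then m = δp divides the difference as soon as p divides the cubic
-- factor, and δ ≥ 39 keeps b ≤ n. Multiplied by 12 the cubic factor is (6a + 3d)² + 3d² + 12, so
-- it suffices to find a point (d, w) of the conic w² + 3d² + 12 ≡ 0 (mod p) with d ≡ ±δt.
-- A first point comes from the pigeonhole principle applied to x² and −12 − 3y²; the chords
-- through it parametrise further points injectively by their slope. Coding a chord point by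
-- d and the half of [0, p) containing w, and each ±δt once for each half, puts p + 4T objects
-- into 2p + 2 codes; for p ≥ 31 this forces a collision, which can only be a point with
-- d ≡ ±δt. The primes below 31 are checked by evaluation.
module Submission where

open import Data.Bool using (Bool; true; false)
open import Data.Empty using (⊥-elim)
open import Data.Fin as Fin using (Fin; toℕ; fromℕ<)
import Data.Fin.Properties as Fin
open import Data.Nat as ℕ using (ℕ; zero; suc; z≤n; s≤s)
import Data.Nat.Properties as ℕ
open import Data.Nat.Primality using (Prime; prime⇒nonZero; euclidsLemma)
open import Data.Product as Product using (∃-syntax; ∃₂; _×_; _,_; proj₁; proj₂)
open import Data.Product.Function.NonDependent.Propositional using (_×-↔_)
open import Data.Sum as Sum using (_⊎_; inj₁; inj₂; [_,_])
open import Data.Sum.Function.Propositional using (_⊎-↔_)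
open import Data.Sum.Properties using (inj₁-injective; inj₂-injective)
open import Function using (_∘_; id)
open import Function.Bundles using (_↣_; _↔_; Injection)
open import Function.Construct.Identity using (↣-id; ↔-id)
open import Function.Properties.Inverse using (↔⇒↣; ↔-trans; ↔-sym)
open import Relation.Nullary using (¬_; Dec; yes; no)
open import Relation.Nullary.Decidable using (map′)
open import Relation.Binary.PropositionalEquality hiding ([_])

collision : ∀ {A C : Set} {N M} → Fin N ↣ A → C ↣ Fin M → M ℕ.< N →
            (f : A → C) → ∃₂ λ x y → x ≢ y × f x ≡ f y
collision ι κ M<N f with i , j , i<j , eq ← Fin.pigeonhole M<N (Injection.to κ ∘ f ∘ Injection.to ι) =
  Injection.to ι i , Injection.to ι j , Fin.<⇒≢ i<j ∘ Injection.injective ι , Injection.injective κ eq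

Fin*2↔Fin×Bool : ∀ {n} → Fin (n ℕ.* 2) ↔ (Fin n × Bool)
Fin*2↔Fin×Bool = ↔-trans Fin.*↔× (↔-id _ ×-↔ Fin.2↔Bool)

module Modular (p : ℕ) (p-prime : Prime p) where
  open import Data.Integer using (ℤ; +_; 0ℤ; 1ℤ; _+_; _*_; _-_; -_)
  import Data.Integer.Properties as ℤ
  open import Data.Integer.DivMod using (_%ℕ_; _/ℕ_; n%ℕd<d; a≡a%ℕn+[a/ℕn]*n)
  open import Data.Integer.Divisibility.Signed
    using (_∣_; divides; ∣⇒∣ᵤ; ∣ᵤ⇒∣; ∣m∣n⇒∣m+n; ∣m⇒∣-m; ∣m⇒∣m*n; ∣n⇒∣m*n)
  import Data.Nat.Divisibility as ℕ
  open import Data.Nat.Coprimality using (prime⇒coprime; coprime-Bézout)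
  open import Data.Nat.GCD using (module Bézout)
  open import Data.Integer.Tactic.RingSolver using (solve-∀)
  open import Relation.Binary.Bundles using (Setoid)

  instance
    p-nonZero : ℕ.NonZero p
    p-nonZero = prime⇒nonZero p-prime

  infix 4 _≈_ _≉_
  record _≈_ (x y : ℤ) : Set where
    constructor mk≈
    field p∣x-y : + p ∣ x - y

  _≉_ : ℤ → ℤ → Set
  x ≉ y = ¬ x ≈ y

  ≈-reflexive : ∀ {x y} → x ≡ y → x ≈ y
  ≈-reflexive {x} refl = mk≈ (divides 0ℤ (ℤ.+-inverseʳ x))

  ≈-refl : ∀ {x} → x ≈ x
  ≈-refl = ≈-reflexive refl

  ≈-sym : ∀ {x y} → x ≈ y → y ≈ x
  ≈-sym {x} {y} (mk≈ p∣x-y) = mk≈ (subst (+ p ∣_) (ring x y) (∣m⇒∣-m p∣x-y))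
    where ring : ∀ x y → - (x - y) ≡ y - x
          ring = solve-∀

  ≈-trans : ∀ {x y z} → x ≈ y → y ≈ z → x ≈ z
  ≈-trans {x} {y} {z} (mk≈ p∣x-y) (mk≈ p∣y-z) = mk≈ (subst (+ p ∣_) (ring x y z) (∣m∣n⇒∣m+n p∣x-y p∣y-z))
    where ring : ∀ x y z → (x - y) + (y - z) ≡ x - z
          ring = solve-∀

  ≈-setoid : Setoid _ _
  ≈-setoid = record
    { Carrier = ℤ ; _≈_ = _≈_
    ; isEquivalence = record { refl = ≈-refl ; sym = ≈-sym ; trans = ≈-trans } }

  +-cong : ∀ {x x′ y y′} → x ≈ x′ → y ≈ y′ → x + y ≈ x′ + y′
  +-cong {x} {x′} {y} {y′} (mk≈ p∣x-x′) (mk≈ p∣y-y′) =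
    mk≈ (subst (+ p ∣_) (ring x x′ y y′) (∣m∣n⇒∣m+n p∣x-x′ p∣y-y′))
    where ring : ∀ x x′ y y′ → (x - x′) + (y - y′) ≡ (x + y) - (x′ + y′)
          ring = solve-∀

  *-cong : ∀ {x x′ y y′} → x ≈ x′ → y ≈ y′ → x * y ≈ x′ * y′
  *-cong {x} {x′} {y} {y′} (mk≈ p∣x-x′) (mk≈ p∣y-y′) =
    mk≈ (subst (+ p ∣_) (ring x x′ y y′) (∣m∣n⇒∣m+n (∣m⇒∣m*n y p∣x-x′) (∣n⇒∣m*n x′ p∣y-y′)))
    where ring : ∀ x x′ y y′ → (x - x′) * y + x′ * (y - y′) ≡ x * y - x′ * y′
          ring = solve-∀

  -‿cong : ∀ {x x′} → x ≈ x′ → - x ≈ - x′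
  -‿cong {x} {x′} (mk≈ p∣x-x′) = mk≈ (subst (+ p ∣_) (ring x x′) (∣m⇒∣-m p∣x-x′))
    where ring : ∀ x x′ → - (x - x′) ≡ - x - - x′
          ring = solve-∀

  p∣⇒≈0 : ∀ {x} → + p ∣ x → x ≈ 0ℤ
  p∣⇒≈0 {x} = mk≈ ∘ subst (+ p ∣_) (sym (ℤ.+-identityʳ x))

  ≈0⇒p∣ : ∀ {x} → x ≈ 0ℤ → + p ∣ x
  ≈0⇒p∣ {x} (mk≈ p∣x-0) = subst (+ p ∣_) (ℤ.+-identityʳ x) p∣x-0

  ≈0⇒p∣ℕ : ∀ {n} → + n ≈ 0ℤ → p ℕ.∣ n
  ≈0⇒p∣ℕ = ∣⇒∣ᵤ ∘ ≈0⇒p∣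

  x*y≈0⇒x≈0∨y≈0 : ∀ x y → x * y ≈ 0ℤ → x ≈ 0ℤ ⊎ y ≈ 0ℤ
  x*y≈0⇒x≈0∨y≈0 x y xy≈0 = Sum.map (p∣⇒≈0 ∘ ∣ᵤ⇒∣) (p∣⇒≈0 ∘ ∣ᵤ⇒∣)
    (euclidsLemma _ _ p-prime (subst (p ℕ.∣_) (ℤ.abs-* x y) (∣⇒∣ᵤ (≈0⇒p∣ xy≈0))))

  ≈⇒-≈0 : ∀ {x y} → x ≈ y → x - y ≈ 0ℤ
  ≈⇒-≈0 = p∣⇒≈0 ∘ _≈_.p∣x-y

  -≈0⇒≈ : ∀ {x y} → x - y ≈ 0ℤ → x ≈ y
  -≈0⇒≈ = mk≈ ∘ ≈0⇒p∣

  +-cancelˡ-≈ : ∀ c {x y} → c + x ≈ c + y → x ≈ y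
  +-cancelˡ-≈ c {x} {y} (mk≈ p∣) = mk≈ (subst (+ p ∣_) (ring c x y) p∣)
    where ring : ∀ c x y → (c + x) - (c + y) ≡ x - y
          ring = solve-∀

  +-cancelʳ-≈ : ∀ c {x y} → x + c ≈ y + c → x ≈ y
  +-cancelʳ-≈ c {x} {y} (mk≈ p∣) = mk≈ (subst (+ p ∣_) (ring c x y) p∣)
    where ring : ∀ c x y → (x + c) - (y + c) ≡ x - y
          ring = solve-∀

  -‿cancel-≈ : ∀ {x y} → - x ≈ - y → x ≈ y
  -‿cancel-≈ {x} {y} -x≈-y = subst₂ _≈_ (ℤ.neg-involutive x) (ℤ.neg-involutive y) (-‿cong -x≈-y)

  *≈0-cancelˡ : ∀ {c x} → c ≉ 0ℤ → c * x ≈ 0ℤ → x ≈ 0ℤ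
  *≈0-cancelˡ c≉0 cx≈0 = [ ⊥-elim ∘ c≉0 , id ] (x*y≈0⇒x≈0∨y≈0 _ _ cx≈0)

  *-cancelˡ-≈ : ∀ {c x y} → c ≉ 0ℤ → c * x ≈ c * y → x ≈ y
  *-cancelˡ-≈ {c} {x} {y} c≉0 cx≈cy =
    -≈0⇒≈ (*≈0-cancelˡ c≉0 (subst (_≈ 0ℤ) (ring c x y) (≈⇒-≈0 cx≈cy)))
    where ring : ∀ c x y → c * x - c * y ≡ c * (x - y)
          ring = solve-∀

  square≈square : ∀ {x y} → x * x ≈ y * y → x ≈ y ⊎ x + y ≈ 0ℤ
  square≈square {x} {y} x²≈y² =
    Sum.map₁ -≈0⇒≈ (x*y≈0⇒x≈0∨y≈0 (x - y) (x + y) (subst (_≈ 0ℤ) (ring x y) (≈⇒-≈0 x²≈y²)))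
    where ring : ∀ x y → x * x - y * y ≡ (x - y) * (x + y)
          ring = solve-∀

  +≈0⇒≡0 : ∀ {n} → n ℕ.< p → + n ≈ 0ℤ → n ≡ 0
  +≈0⇒≡0 {zero}  _   _   = refl
  +≈0⇒≡0 {suc n} n<p n≈0 = ⊥-elim (ℕ.<⇒≱ n<p (ℕ.∣⇒≤ (≈0⇒p∣ℕ n≈0)))

  +≈0⇒≡0∨≡p : ∀ {n} → n ℕ.< p ℕ.+ p → + n ≈ 0ℤ → n ≡ 0 ⊎ n ≡ p
  +≈0⇒≡0∨≡p n<2p n≈0 with ≈0⇒p∣ℕ n≈0
  ... | ℕ.divides zero          refl = inj₁ refl
  ... | ℕ.divides (suc zero)    refl = inj₂ (ℕ.+-identityʳ p)
  ... | ℕ.divides (suc (suc q)) refl = ⊥-elim (ℕ.<⇒≱ n<2p (ℕ.+-monoʳ-≤ p (ℕ.m≤m+n p (q ℕ.* p))))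

  private
    ≤∧≈⇒≡ : ∀ {a b} → a ℕ.≤ b → b ℕ.< p → + b ≈ + a → a ≡ b
    ≤∧≈⇒≡ {a} {b} a≤b b<p b≈a =
      ℕ.≤-antisym a≤b (ℕ.m∸n≡0⇒m≤n (+≈0⇒≡0 (ℕ.≤-<-trans (ℕ.m∸n≤m b a) b<p) b-a≈0))
      where b-a≈0 : + (b ℕ.∸ a) ≈ 0ℤ
            b-a≈0 = subst (_≈ 0ℤ) (trans (ℤ.m-n≡m⊖n b a) (ℤ.⊖-≥ a≤b)) (≈⇒-≈0 b≈a)

  ≈⇒≡ : ∀ {a b} → a ℕ.< p → b ℕ.< p → + a ≈ + b → a ≡ b
  ≈⇒≡ {a} {b} a<p b<p a≈b with ℕ.≤-total a b
  ... | inj₁ a≤b = ≤∧≈⇒≡ a≤b b<p (≈-sym a≈b)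
  ... | inj₂ b≤a = sym (≤∧≈⇒≡ b≤a a<p a≈b)

  -- Opaque, so that unification sees `residue x` rather than its unfolding.
  opaque
    residue : ℤ → Fin p
    residue x = fromℕ< (n%ℕd<d x p)

    ≈residue : ∀ x → x ≈ + toℕ (residue x)
    ≈residue x = mk≈ (divides (x /ℕ p) (begin
      x - + toℕ (residue x)  ≡⟨ cong (λ r → x - + r) (Fin.toℕ-fromℕ< (n%ℕd<d x p)) ⟩
      x - + (x %ℕ p)         ≡⟨ cong (_- + (x %ℕ p)) (a≡a%ℕn+[a/ℕn]*n x p) ⟩
      (+ (x %ℕ p) + x /ℕ p * + p) - + (x %ℕ p) ≡⟨ ring (+ (x %ℕ p)) (x /ℕ p) (+ p) ⟩
      x /ℕ p * + p           ∎))
      where open ≡-Reasoning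
            ring : ∀ r q p → (r + q * p) - r ≡ q * p
            ring = solve-∀

  residue-injective : ∀ {x y} → residue x ≡ residue y → x ≈ y
  residue-injective {x} {y} eq =
    ≈-trans (≈residue x) (≈-trans (≈-reflexive (cong (+_ ∘ toℕ) eq)) (≈-sym (≈residue y)))

  residue-cong : ∀ {x y} → x ≈ y → residue x ≡ residue y
  residue-cong {x} {y} x≈y = Fin.toℕ-injective (≈⇒≡ (Fin.toℕ<n (residue x)) (Fin.toℕ<n (residue y))
    (≈-trans (≈-sym (≈residue x)) (≈-trans x≈y (≈residue y))))

  _≈0? : ∀ x → Dec (x ≈ 0ℤ)
  x ≈0? = map′ residue-injective residue-cong (residue x Fin.≟ residue 0ℤ)

  positive-representative : ∀ x → ∃[ a ] 1 ℕ.≤ a × a ℕ.≤ p × + a ≈ x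
  positive-representative x = suc r , s≤s z≤n , Fin.toℕ<n (residue (x - 1ℤ)) , (begin
    1ℤ + + r          ≈⟨ +-cong (≈-refl {1ℤ}) (≈residue (x - 1ℤ)) ⟨
    1ℤ + (x - 1ℤ)     ≡⟨ ring x ⟩
    x                 ∎)
    where open import Relation.Binary.Reasoning.Setoid ≈-setoid
          r = toℕ (residue (x - 1ℤ))
          ring : ∀ x → 1ℤ + (x - 1ℤ) ≡ x
          ring = solve-∀

  ≉0⇒residue≢0 : ∀ {x} → x ≉ 0ℤ → toℕ (residue x) ≢ 0
  ≉0⇒residue≢0 {x} x≉0 r≡0 = x≉0 (≈-trans (≈residue x) (≈-reflexive (cong +_ r≡0)))

  private
    ℕ-identity⇒ℤ : ∀ x y u v → 1 ℕ.+ x ℕ.* y ≡ u ℕ.* v → 1ℤ + + x * + y ≡ + u * + v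
    ℕ-identity⇒ℤ x y u v eq = begin
      1ℤ + + x * + y     ≡⟨ cong (_+_ 1ℤ) (ℤ.pos-* x y) ⟨
      + (1 ℕ.+ x ℕ.* y)  ≡⟨ cong +_ eq ⟩
      + (u ℕ.* v)        ≡⟨ ℤ.pos-* u v ⟩
      + u * + v          ∎
      where open ≡-Reasoning

    bézout⇒inverse : ∀ {r} → Bézout.Identity 1 p r → ∃[ y ] + r * y ≈ 1ℤ
    bézout⇒inverse {r} (Bézout.+- a b eq) = - + b , mk≈ (divides (- + a) (begin
      + r * - + b - 1ℤ     ≡⟨ ring (+ r) (+ b) ⟩
      - (1ℤ + + b * + r)   ≡⟨ cong -_ (ℕ-identity⇒ℤ b r a p eq) ⟩
      - (+ a * + p)        ≡⟨ ℤ.neg-distribˡ-* (+ a) (+ p) ⟩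
      - + a * + p          ∎))
      where open ≡-Reasoning
            ring : ∀ r b → r * - b - 1ℤ ≡ - (1ℤ + b * r)
            ring = solve-∀
    bézout⇒inverse {r} (Bézout.-+ a b eq) = + b , mk≈ (divides (+ a) (begin
      + r * + b - 1ℤ         ≡⟨ cong (_- 1ℤ) (ℤ.*-comm (+ r) (+ b)) ⟩
      + b * + r - 1ℤ         ≡⟨ cong (_- 1ℤ) (ℕ-identity⇒ℤ a p b r eq) ⟨
      (1ℤ + + a * + p) - 1ℤ  ≡⟨ ring (+ a * + p) ⟩
      + a * + p              ∎))
      where open ≡-Reasoning
            ring : ∀ x → (1ℤ + x) - 1ℤ ≡ x
            ring = solve-∀

    <p⇒inverse : ∀ {r} → r ≢ 0 → r ℕ.< p → ∃[ y ] + r * y ≈ 1ℤ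
    <p⇒inverse {zero}  r≢0 _   = ⊥-elim (r≢0 refl)
    <p⇒inverse {suc _} _   r<p = bézout⇒inverse (coprime-Bézout (prime⇒coprime p-prime r<p))

  inverse : ∀ {x} → x ≉ 0ℤ → ∃[ y ] x * y ≈ 1ℤ
  inverse {x} x≉0 = Product.map₂ (≈-trans (*-cong (≈residue x) ≈-refl))
    (<p⇒inverse (≉0⇒residue≢0 x≉0) (Fin.toℕ<n (residue x)))

module _ where
  open import Data.Integer using (ℤ; +_; _+_; _*_)

  conic : ℤ → ℤ → ℤ
  conic d w = w * w + + 3 * (d * d) + + 12

module OddPrime (p h : ℕ) (p-prime : Prime p) (p≡2h+1 : p ≡ suc (h ℕ.+ h)) (5≤p : 5 ℕ.≤ p) where
  open import Data.Integer using (ℤ; +_; 0ℤ; 1ℤ; _+_; _*_; _-_; -_)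
  import Data.Integer.Properties as ℤ
  open import Data.Integer.Tactic.RingSolver using (solve-∀)
  open Modular p p-prime
  open import Relation.Binary.Reasoning.Setoid ≈-setoid

  ≤2h⇒<p : ∀ {n} → n ℕ.≤ h ℕ.+ h → n ℕ.< p
  ≤2h⇒<p n≤2h = subst (_ ℕ.<_) (sym p≡2h+1) (s≤s n≤2h)

  ≤h⇒<p : ∀ {n} → n ℕ.≤ h → n ℕ.< p
  ≤h⇒<p n≤h = ≤2h⇒<p (ℕ.≤-trans n≤h (ℕ.m≤m+n h h))

  +≉0 : ∀ {n} → suc n ℕ.< p → + suc n ≉ 0ℤ
  +≉0 n<p n≈0 = ℕ.1+n≢0 (+≈0⇒≡0 n<p n≈0)

  2≉0 : + 2 ≉ 0ℤ
  2≉0 = +≉0 (ℕ.<-≤-trans (s≤s (s≤s (s≤s z≤n))) 5≤p)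

  3≉0 : + 3 ≉ 0ℤ
  3≉0 = +≉0 (ℕ.<-≤-trans (s≤s (s≤s (s≤s (s≤s z≤n)))) 5≤p)

  6≉0 : + 6 ≉ 0ℤ
  6≉0 = [ 2≉0 , 3≉0 ] ∘ x*y≈0⇒x≈0∨y≈0 (+ 2) (+ 3)

  12≉0 : + 12 ≉ 0ℤ
  12≉0 = [ 2≉0 , 6≉0 ] ∘ x*y≈0⇒x≈0∨y≈0 (+ 2) (+ 6)

  upper : ℕ → Bool
  upper a with h ℕ.<? a
  ... | yes _ = true
  ... | no  _ = false

  ≤h⇒¬upper : ∀ {a} → a ℕ.≤ h → upper a ≡ false
  ≤h⇒¬upper {a} a≤h with h ℕ.<? a
  ... | yes h<a = ⊥-elim (ℕ.≤⇒≯ a≤h h<a)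
  ... | no  _   = refl

  private
    same-half⇒sum≢p : ∀ {a b} → upper a ≡ upper b → a ℕ.+ b ≢ p
    same-half⇒sum≢p {a} {b} same a+b≡p with h ℕ.<? a | h ℕ.<? b | same
    ... | yes h<a | yes h<b | _ = ℕ.<-irrefl (sym a+b≡p) (subst (ℕ._< a ℕ.+ b) (sym p≡2h+1)
          (ℕ.≤-trans (s≤s (ℕ.≤-reflexive (sym (ℕ.+-suc h h)))) (ℕ.+-mono-≤ h<a h<b)))
    ... | no h≮a  | no h≮b  | _ = ℕ.<-irrefl a+b≡p (≤2h⇒<p (ℕ.+-mono-≤ (ℕ.≮⇒≥ h≮a) (ℕ.≮⇒≥ h≮b)))
    ... | yes _   | no _    | ()
    ... | no _    | yes _   | ()

  square-injective : ∀ {a b} → a ℕ.< p → b ℕ.< p → upper a ≡ upper b →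
                     + a * + a ≈ + b * + b → a ≡ b
  square-injective {a} {b} a<p b<p same a²≈b² =
    [ ≈⇒≡ a<p b<p , [ both-zero , ⊥-elim ∘ same-half⇒sum≢p same ] ∘ +≈0⇒≡0∨≡p (ℕ.+-mono-< a<p b<p) ]
      (square≈square a²≈b²)
    where both-zero : a ℕ.+ b ≡ 0 → a ≡ b
          both-zero a+b≡0 = trans (ℕ.m+n≡0⇒m≡0 a a+b≡0) (sym (ℕ.m+n≡0⇒n≡0 a a+b≡0))

  square-injective-≤h : ∀ {a b} → a ℕ.≤ h → b ℕ.≤ h → + a * + a ≈ + b * + b → a ≡ b
  square-injective-≤h a≤h b≤h =
    square-injective (≤h⇒<p a≤h) (≤h⇒<p b≤h) (trans (≤h⇒¬upper a≤h) (sym (≤h⇒¬upper b≤h)))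

  record Point : Set where
    field
      d w      : ℤ
      on-conic : conic d w ≈ 0ℤ

  w²≈-12-3d²⇒on-conic : ∀ d w → w * w ≈ - + 12 - + 3 * (d * d) → conic d w ≈ 0ℤ
  w²≈-12-3d²⇒on-conic d w w²≈ = subst (_≈ 0ℤ) (ring d w) (≈⇒-≈0 w²≈)
    where ring : ∀ d w → w * w - (- + 12 - + 3 * (d * d)) ≡ w * w + + 3 * (d * d) + + 12
          ring = solve-∀

  private
    square : Fin (suc h) → ℤ
    square x = + toℕ x * + toℕ x

    w²-or-[-12-3d²] : Fin (suc h) ⊎ Fin (suc h) → Fin p
    w²-or-[-12-3d²] (inj₁ x) = residue (square x)
    w²-or-[-12-3d²] (inj₂ y) = residue (- + 12 - + 3 * square y)

    [-12-3*]-injective : ∀ a b → - + 12 - + 3 * a ≈ - + 12 - + 3 * b → a ≈ b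
    [-12-3*]-injective a b = *-cancelˡ-≈ 3≉0 ∘ -‿cancel-≈ ∘ +-cancelˡ-≈ (- + 12)

    toℕ≤h : (x : Fin (suc h)) → toℕ x ℕ.≤ h
    toℕ≤h x = ℕ.≤-pred (Fin.toℕ<n x)

    point : ∀ x y → square x ≈ - + 12 - + 3 * square y → Point
    point x y eq = record { d = + toℕ y ; w = + toℕ x ; on-conic = w²≈-12-3d²⇒on-conic (+ toℕ y) (+ toℕ x) eq }

    p<2h+2 : p ℕ.< suc h ℕ.+ suc h
    p<2h+2 = subst₂ ℕ._<_ (sym p≡2h+1) (sym (cong suc (ℕ.+-suc h h))) ℕ.≤-refl

  conic-point : Point
  conic-point with collision (↔⇒↣ Fin.+↔⊎) (↣-id _) p<2h+2 w²-or-[-12-3d²]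
  ... | inj₁ x , inj₁ y , x≢y , eq = ⊥-elim (x≢y (cong inj₁ (Fin.toℕ-injective
          (square-injective-≤h (toℕ≤h x) (toℕ≤h y) (residue-injective eq)))))
  ... | inj₂ x , inj₂ y , x≢y , eq = ⊥-elim (x≢y (cong inj₂ (Fin.toℕ-injective
          (square-injective-≤h (toℕ≤h x) (toℕ≤h y)
            ([-12-3*]-injective (square x) (square y) (residue-injective eq))))))
  ... | inj₁ x , inj₂ y , _ , eq = point x y (residue-injective eq)
  ... | inj₂ y , inj₁ x , _ , eq = point x y (residue-injective (sym eq))

  conic-cong : ∀ {d d′ w w′} → d ≈ d′ → w ≈ w′ → conic d w ≈ conic d′ w′
  conic-cong d≈d′ w≈w′ = +-cong (+-cong (*-cong w≈w′ w≈w′) (*-cong (≈-refl {+ 3}) (*-cong d≈d′ d≈d′))) ≈-refl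

  -- d fixes w up to sign, and the half of [0, p) containing w fixes the sign.
  code : Point → Fin p × Bool
  code P = residue (Point.d P) , upper (toℕ (residue (Point.w P)))

  code-injective : ∀ P Q → code P ≡ code Q → Point.d P ≈ Point.d Q × Point.w P ≈ Point.w Q
  code-injective P Q eq = d≈d′ , w≈w′
    where
    open Point P
    open Point Q renaming (d to d′; w to w′; on-conic to on-conic′)
    r  = toℕ (residue w)
    r′ = toℕ (residue w′)

    d≈d′ : d ≈ d′
    d≈d′ = residue-injective (cong proj₁ eq)

    w²≈w′² : w * w ≈ w′ * w′
    w²≈w′² = -≈0⇒≈ (subst (_≈ 0ℤ) (ring d w w′) (≈⇒-≈0 (begin
      conic d w   ≈⟨ on-conic ⟩
      0ℤ          ≈⟨ on-conic′ ⟨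
      conic d′ w′ ≈⟨ conic-cong (≈-sym d≈d′) (≈-refl {w′}) ⟩
      conic d w′  ∎)))
      where ring : ∀ d w w′ → (w * w + + 3 * (d * d) + + 12) - (w′ * w′ + + 3 * (d * d) + + 12) ≡ w * w - w′ * w′
            ring = solve-∀

    w≈w′ : w ≈ w′
    w≈w′ = residue-injective (Fin.toℕ-injective (square-injective
      (Fin.toℕ<n (residue w)) (Fin.toℕ<n (residue w′)) (cong proj₂ eq) (begin
        + r * + r   ≈⟨ *-cong (≈residue w) (≈residue w) ⟨
        w * w       ≈⟨ w²≈w′² ⟩
        w′ * w′     ≈⟨ *-cong (≈residue w′) (≈residue w′) ⟩
        + r′ * + r′ ∎)))

  module Chords (P₀ : Point) where
    open Point P₀ renaming (d to d₀; w to w₀; on-conic to on₀)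

    norm : ℤ → ℤ
    norm L = L * L + + 3

    linear : ℤ → ℤ
    linear L = + 6 * d₀ + + 2 * w₀ * L

    -- The line (d₀ + s, w₀ + s L) meets the conic at s = 0 and s = − linear L / norm L.
    parameter : (L : ℤ) → norm L ≉ 0ℤ → ℤ
    parameter L n≉0 = - linear L * proj₁ (inverse n≉0)

    parameter-norm : ∀ L (n≉0 : norm L ≉ 0ℤ) → parameter L n≉0 * norm L ≈ - linear L
    parameter-norm L n≉0 = begin
      - linear L * e * norm L    ≡⟨ ℤ.*-assoc (- linear L) e (norm L) ⟩
      - linear L * (e * norm L)  ≈⟨ *-cong (≈-refl { - linear L}) (≈-trans (≈-reflexive (ℤ.*-comm e (norm L))) ne≈1) ⟩
      - linear L * 1ℤ            ≡⟨ ℤ.*-identityʳ (- linear L) ⟩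
      - linear L                 ∎
      where e = proj₁ (inverse n≉0)
            ne≈1 = proj₂ (inverse n≉0)

    chord : (L : ℤ) → norm L ≉ 0ℤ → Point
    chord L n≉0 = record
      { d = d₀ + s ; w = w₀ + s * L
      ; on-conic = begin
          conic (d₀ + s) (w₀ + s * L)                         ≡⟨ ring d₀ w₀ L s ⟩
          conic d₀ w₀ + s * linear L + s * (s * norm L)       ≈⟨ +-cong (≈-refl {conic d₀ w₀ + s * linear L})
                                                                    (*-cong (≈-refl {s}) (parameter-norm L n≉0)) ⟩
          conic d₀ w₀ + s * linear L + s * - linear L         ≡⟨ ring′ (conic d₀ w₀) s (linear L) ⟩
          conic d₀ w₀                                         ≈⟨ on₀ ⟩
          0ℤ                                                  ∎ }
      where
      s = parameter L n≉0
      ring : ∀ d w L s → (w + s * L) * (w + s * L) + + 3 * ((d + s) * (d + s)) + + 12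
                       ≡ (w * w + + 3 * (d * d) + + 12) + s * (+ 6 * d + + 2 * w * L) + s * (s * (L * L + + 3))
      ring = solve-∀
      ring′ : ∀ c s l → c + s * l + s * - l ≡ c
      ring′ = solve-∀

    private
      linear≈0 : ∀ {L} (n≉0 : norm L ≉ 0ℤ) → parameter L n≉0 ≈ 0ℤ → linear L ≈ 0ℤ
      linear≈0 {L} n≉0 s≈0 = -‿cancel-≈ (begin
        - linear L                ≈⟨ parameter-norm L n≉0 ⟨
        parameter L n≉0 * norm L  ≈⟨ *-cong s≈0 (≈-refl {norm L}) ⟩
        0ℤ * norm L               ≡⟨ ℤ.*-zeroˡ (norm L) ⟩
        0ℤ                        ∎)

      2w₀≉0 : ∀ {L} → linear L ≈ 0ℤ → + 2 * w₀ ≉ 0ℤ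
      2w₀≉0 {L} lin≈0 2w₀≈0 = 12≉0 (begin
        conic 0ℤ 0ℤ  ≈⟨ conic-cong d₀≈0 (*≈0-cancelˡ 2≉0 2w₀≈0) ⟨
        conic d₀ w₀  ≈⟨ on₀ ⟩
        0ℤ           ∎)
        where
        d₀≈0 : d₀ ≈ 0ℤ
        d₀≈0 = *≈0-cancelˡ 6≉0 (begin
          + 6 * d₀                 ≡⟨ ring (+ 6 * d₀) L ⟨
          + 6 * d₀ + 0ℤ * L        ≈⟨ +-cong (≈-refl {+ 6 * d₀}) (*-cong 2w₀≈0 (≈-refl {L})) ⟨
          linear L                 ≈⟨ lin≈0 ⟩
          0ℤ                       ∎)
          where ring : ∀ x L → x + 0ℤ * L ≡ x
                ring = solve-∀

      linear-injective : ∀ L L′ → linear L ≈ 0ℤ → linear L′ ≈ 0ℤ → L ≈ L′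
      linear-injective L L′ lin≈0 lin′≈0 =
        *-cancelˡ-≈ (2w₀≉0 {L} lin≈0) (+-cancelˡ-≈ (+ 6 * d₀) (≈-trans lin≈0 (≈-sym lin′≈0)))

    chord-injective : ∀ {L L′} (n≉0 : norm L ≉ 0ℤ) (n′≉0 : norm L′ ≉ 0ℤ) →
                      Point.d (chord L n≉0) ≈ Point.d (chord L′ n′≉0) →
                      Point.w (chord L n≉0) ≈ Point.w (chord L′ n′≉0) → L ≈ L′
    chord-injective {L} {L′} n≉0 n′≉0 d≈d′ w≈w′ = cases (s ≈0?)
      where
      s  = parameter L n≉0
      s′ = parameter L′ n′≉0
      s≈s′ : s ≈ s′
      s≈s′ = +-cancelˡ-≈ d₀ d≈d′
      cases : Dec (s ≈ 0ℤ) → L ≈ L′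
      cases (no s≉0) = *-cancelˡ-≈ s≉0 (begin
        s * L     ≈⟨ +-cancelˡ-≈ w₀ w≈w′ ⟩
        s′ * L′   ≈⟨ *-cong s≈s′ (≈-refl {L′}) ⟨
        s * L′    ∎)
      cases (yes s≈0) = linear-injective L L′ (linear≈0 n≉0 s≈0) (linear≈0 n′≉0 (≈-trans (≈-sym s≈s′) s≈0))

  signed : Bool → ℤ → ℤ
  signed true  x = x
  signed false x = - x

  conic-signed : ∀ σ d w → conic (signed σ d) w ≡ conic d w
  conic-signed true  d w = refl
  conic-signed false d w = ring d w
    where ring : ∀ d w → w * w + + 3 * (- d * - d) + + 12 ≡ w * w + + 3 * (d * d) + + 12
          ring = solve-∀

  module Counting {δ : ℤ} (δ≉0 : δ ≉ 0ℤ) {T : ℕ} (T≤h : T ℕ.≤ h) where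
    multiple : Fin T → ℤ
    multiple t = δ * + suc (toℕ t)

    private
      suc≤h : (t : Fin T) → suc (toℕ t) ℕ.≤ h
      suc≤h t = ℕ.≤-trans (Fin.toℕ<n t) T≤h

      multiple-injective : ∀ {t t′} → multiple t ≈ multiple t′ → t ≡ t′
      multiple-injective {t} {t′} eq = Fin.toℕ-injective (ℕ.suc-injective
        (≈⇒≡ (≤h⇒<p (suc≤h t)) (≤h⇒<p (suc≤h t′)) (*-cancelˡ-≈ δ≉0 eq)))

      multiple≉-multiple : ∀ t t′ → multiple t ≉ - multiple t′
      multiple≉-multiple t t′ eq = ℕ.1+n≢0 (+≈0⇒≡0 (≤2h⇒<p (ℕ.+-mono-≤ (suc≤h t) (suc≤h t′)))
        (*≈0-cancelˡ δ≉0 (subst (_≈ 0ℤ) (ring δ (+ suc (toℕ t)) (+ suc (toℕ t′))) (≈⇒-≈0 eq))))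
        where ring : ∀ δ a b → δ * a - - (δ * b) ≡ δ * (a + b)
              ring = solve-∀

    signed-multiple-injective : ∀ {t t′} σ σ′ → signed σ (multiple t) ≈ signed σ′ (multiple t′) →
                                (t , σ) ≡ (t′ , σ′)
    signed-multiple-injective true  true  eq = cong (_, true) (multiple-injective eq)
    signed-multiple-injective false false eq = cong (_, false) (multiple-injective (-‿cancel-≈ eq))
    signed-multiple-injective {t} {t′} true false eq = ⊥-elim (multiple≉-multiple t t′ eq)
    signed-multiple-injective {t} {t′} false true eq = ⊥-elim (multiple≉-multiple t′ t (≈-sym eq))

    open Chords conic-point

    Candidate : Set
    Candidate = Fin p ⊎ ((Fin T × Bool) × Bool)

    Code : Set
    Code = (Fin p × Bool) ⊎ Bool

    -- The slopes with L² ≡ −3 (at most two, told apart by their half) get codes of their own.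
    slope-code : (a : Fin p) → Dec (norm (+ toℕ a) ≈ 0ℤ) → Code
    slope-code a (yes _)   = inj₂ (upper (toℕ a))
    slope-code a (no n≉0)  = inj₁ (code (chord (+ toℕ a) n≉0))

    encode : Candidate → Code
    encode (inj₁ a)               = slope-code a (norm (+ toℕ a) ≈0?)
    encode (inj₂ ((t , σ) , b))   = inj₁ (residue (signed σ (multiple t)) , b)

    slope-code-injective : ∀ a a′ da da′ → slope-code a da ≡ slope-code a′ da′ → a ≡ a′
    slope-code-injective a a′ (yes n≈0) (yes n′≈0) eq = Fin.toℕ-injective
      (square-injective (Fin.toℕ<n a) (Fin.toℕ<n a′) (inj₂-injective eq)
        (+-cancelʳ-≈ (+ 3) (≈-trans n≈0 (≈-sym n′≈0))))
    slope-code-injective a a′ (no n≉0) (no n′≉0) eq = Fin.toℕ-injective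
      (≈⇒≡ (Fin.toℕ<n a) (Fin.toℕ<n a′) (chord-injective n≉0 n′≉0 (proj₁ d,w≈) (proj₂ d,w≈)))
      where d,w≈ = code-injective (chord (+ toℕ a) n≉0) (chord (+ toℕ a′) n′≉0) (inj₁-injective eq)
    slope-code-injective a a′ (yes _) (no _) ()
    slope-code-injective a a′ (no _) (yes _) ()

    slope-code-hits-multiple : ∀ a da t σ b → slope-code a da ≡ inj₁ (residue (signed σ (multiple t)) , b) →
                               ∃[ w ] conic (multiple t) w ≈ 0ℤ
    slope-code-hits-multiple a (yes _)  t σ b ()
    slope-code-hits-multiple a (no n≉0) t σ b eq = w , (begin
      conic (multiple t) w               ≡⟨ conic-signed σ (multiple t) w ⟨
      conic (signed σ (multiple t)) w    ≈⟨ conic-cong d≈ (≈-refl {w}) ⟨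
      conic d w                          ≈⟨ on-conic ⟩
      0ℤ                                 ∎)
      where
      open Point (chord (+ toℕ a) n≉0)
      d≈ : d ≈ signed σ (multiple t)
      d≈ = residue-injective (cong proj₁ (inj₁-injective eq))

    enough-candidates⇒multiple-on-conic : p ℕ.* 2 ℕ.+ 2 ℕ.< p ℕ.+ T ℕ.* 2 ℕ.* 2 →
                                          ∃₂ λ t w → conic (multiple t) w ≈ 0ℤ
    enough-candidates⇒multiple-on-conic enough with collision ι κ enough encode
      where
      ι = ↔⇒↣ (↔-trans Fin.+↔⊎ (↔-id _ ⊎-↔ ↔-trans Fin*2↔Fin×Bool (Fin*2↔Fin×Bool ×-↔ ↔-id _)))
      κ = ↔⇒↣ (↔-sym (↔-trans Fin.+↔⊎ (Fin*2↔Fin×Bool ⊎-↔ Fin.2↔Bool)))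
    ... | inj₁ a , inj₁ a′ , a≢a′ , eq = ⊥-elim (a≢a′ (cong inj₁ (slope-code-injective a a′ _ _ eq)))
    ... | inj₁ a , inj₂ ((t , σ) , b) , _ , eq = t , slope-code-hits-multiple a _ t σ b eq
    ... | inj₂ ((t , σ) , b) , inj₁ a , _ , eq = t , slope-code-hits-multiple a _ t σ b (sym eq)
    ... | inj₂ ((t , σ) , b) , inj₂ ((t′ , σ′) , b′) , x≢x′ , eq
        with signed-multiple-injective σ σ′ (residue-injective (cong proj₁ (inj₁-injective eq)))
           | cong proj₂ (inj₁-injective eq)
    ...   | refl | refl = ⊥-elim (x≢x′ refl)

  private
    6⁻¹ : ℤ
    6⁻¹ = proj₁ (inverse 6≉0)

    6*a+3*d≈w : ∀ {a} d w → a ≈ 6⁻¹ * (w - + 3 * d) → + 6 * a + + 3 * d ≈ w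
    6*a+3*d≈w {a} d w a≈ = begin
      + 6 * a + + 3 * d                     ≈⟨ +-cong (*-cong (≈-refl {+ 6}) a≈) (≈-refl {+ 3 * d}) ⟩
      + 6 * (6⁻¹ * (w - + 3 * d)) + + 3 * d ≡⟨ cong (_+ + 3 * d) (ℤ.*-assoc (+ 6) 6⁻¹ (w - + 3 * d)) ⟨
      + 6 * 6⁻¹ * (w - + 3 * d) + + 3 * d   ≈⟨ +-cong (*-cong (proj₂ (inverse 6≉0)) (≈-refl {w - + 3 * d}))
                                                      (≈-refl {+ 3 * d}) ⟩
      1ℤ * (w - + 3 * d) + + 3 * d          ≡⟨ ring w d ⟩
      w                                     ∎
      where ring : ∀ w d → 1ℤ * (w - + 3 * d) + + 3 * d ≡ w
            ring = solve-∀

  cubic-factor≈0 : ∀ a d w → conic d w ≈ 0ℤ → + 6 * a + + 3 * d ≈ w → + 3 * (a * (a + d)) + d * d + 1ℤ ≈ 0ℤ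
  cubic-factor≈0 a d w on 6a+3d≈w = *≈0-cancelˡ 12≉0 (begin
      + 12 * (+ 3 * (a * (a + d)) + d * d + 1ℤ)  ≡⟨ ring a d ⟩
      conic d (+ 6 * a + + 3 * d)                ≈⟨ conic-cong (≈-refl {d}) 6a+3d≈w ⟩
      conic d w                                  ≈⟨ on ⟩
      0ℤ                                         ∎)
    where ring : ∀ a d → + 12 * (+ 3 * (a * (a + d)) + d * d + 1ℤ)
                       ≡ (+ 6 * a + + 3 * d) * (+ 6 * a + + 3 * d) + + 3 * (d * d) + + 12
          ring = solve-∀

  cubic-factor-root : ∀ d w → conic d w ≈ 0ℤ →
                      ∃[ a ] 1 ℕ.≤ a × a ℕ.≤ p × + 3 * (+ a * (+ a + d)) + d * d + 1ℤ ≈ 0ℤ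
  cubic-factor-root d w on = root (positive-representative (6⁻¹ * (w - + 3 * d)))
    where
    root : ∃[ a ] 1 ℕ.≤ a × a ℕ.≤ p × + a ≈ 6⁻¹ * (w - + 3 * d) →
           ∃[ a ] 1 ℕ.≤ a × a ℕ.≤ p × + 3 * (+ a * (+ a + d)) + d * d + 1ℤ ≈ 0ℤ
    root (a , 1≤a , a≤p , a≈) = a , 1≤a , a≤p , cubic-factor≈0 (+ a) d w on (6*a+3*d≈w d w a≈)

open import Defs
open import Data.Nat using (ℕ; _+_; _*_; _^_; _≤_; _<_; _≥_)
open import Data.Nat.Primality using (Prime)
open import Data.Nat.Divisibility using (_∤_)
open import Data.Product using (_×_; ∃-syntax)
open import Relation.Binary.PropositionalEquality using (_≡_; _≢_)

open import Data.Nat using (_/_; _∸_; _<?_; _≤?_; _≟_)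
open import Data.Nat.DivMod using (m/n*n≤m; m<n*o⇒m/o<n; m≡m%n+[m/n]*n; m%n<n; _%_)
open import Data.Nat.Divisibility using (_∣_; divides; ∣n⇒∣m*n; *-monoʳ-∣)
open import Data.Nat.Primality using (prime?; prime⇒irreducible)
open import Data.Nat.Tactic.RingSolver using (solve-∀)
open import Data.Fin.Properties using (all?; any?)
open import Relation.Nullary using (¬?)
open import Relation.Nullary.Decidable using (from-yes; _→-dec_)
open import Data.Integer as ℤ using (ℤ; +_)
import Data.Integer.Properties as ℤ
import Data.Integer.Divisibility.Signed as ℤ

parity : ∀ n → ∃[ h ] (n ≡ h + h ⊎ n ≡ suc (h + h))
parity zero = 0 , inj₁ refl
parity (suc n) with parity n
... | h , inj₁ refl = h , inj₂ refl
... | h , inj₂ refl = suc h , inj₁ (cong suc (sym (ℕ.+-suc h h)))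

h+h≡h*2 : ∀ h → h + h ≡ h * 2
h+h≡h*2 h = trans (cong (_+_ h) (sym (ℕ.+-identityʳ h))) (ℕ.*-comm 2 h)

prime⇒odd : ∀ {p} → Prime p → 3 ≤ p → ∃[ h ] p ≡ suc (h + h)
prime⇒odd {p} p-prime 3≤p with parity p
... | h , inj₂ p≡2h+1 = h , p≡2h+1
... | h , inj₁ p≡2h with prime⇒irreducible p-prime (divides h (trans p≡2h (h+h≡h*2 h)))
...   | inj₁ ()
...   | inj₂ 2≡p = ⊥-elim (ℕ.<-irrefl 2≡p 3≤p)

⌊12p/39⌋≤h : ∀ {p h} → p ≡ suc (h + h) → 12 * p / 39 ≤ h
⌊12p/39⌋≤h {h = h} refl = ℕ.≤-pred (m<n*o⇒m/o<n (subst (12 * suc (h + h) <_) (ring h) (ℕ.m<m+n _ (s≤s z≤n))))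
  where ring : ∀ h → 12 * suc (h + h) + suc (15 * h + 26) ≡ suc h * 39
        ring = solve-∀

≤⌊12p/39⌋⇒39*≤12p : ∀ {p t} → t ≤ 12 * p / 39 → 39 * t ≤ 12 * p
≤⌊12p/39⌋⇒39*≤12p {p} {t} t≤ =
  ℕ.≤-trans (ℕ.*-monoʳ-≤ 39 t≤) (subst (_≤ 12 * p) (ℕ.*-comm (12 * p / 39) 39) (m/n*n≤m (12 * p) 39))

room-for-large-primes : ∀ {p} → 31 ≤ p → p * 2 + 2 < p + 12 * p / 39 * 2 * 2
room-for-large-primes {p} 31≤p = subst (_≤ p + T * 2 * 2) (ring₁ p) (ℕ.+-monoʳ-≤ p p+3≤4T)
  where
  open ℕ.≤-Reasoning
  T = 12 * p / 39
  r = 12 * p % 39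
  q = p ∸ 31
  p≡31+q : p ≡ 31 + q
  p≡31+q = sym (ℕ.m+[n∸m]≡n 31≤p)

  p+3≤4T : p + 3 ≤ T * 2 * 2
  p+3≤4T = ℕ.*-cancelʳ-≤ (p + 3) (T * 2 * 2) 39 (ℕ.+-cancelʳ-≤ (r * 4) _ _ (begin
    (p + 3) * 39 + r * 4        ≤⟨ ℕ.+-monoʳ-≤ ((p + 3) * 39) (ℕ.*-monoˡ-≤ 4 (ℕ.≤-pred (m%n<n (12 * p) 39))) ⟩
    (p + 3) * 39 + 38 * 4       ≤⟨ ℕ.m≤m+n _ (10 + 9 * q) ⟩
    (p + 3) * 39 + 38 * 4 + (10 + 9 * q)  ≡⟨ cong (λ p → (p + 3) * 39 + 38 * 4 + (10 + 9 * q)) p≡31+q ⟩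
    (31 + q + 3) * 39 + 38 * 4 + (10 + 9 * q)  ≡⟨ ring₂ q ⟩
    12 * (31 + q) * 4           ≡⟨ cong (λ p → 12 * p * 4) p≡31+q ⟨
    12 * p * 4                  ≡⟨ cong (_* 4) (m≡m%n+[m/n]*n (12 * p) 39) ⟩
    (r + T * 39) * 4            ≡⟨ ring₃ r T ⟩
    T * 2 * 2 * 39 + r * 4      ∎))
    where ring₂ : ∀ q → (31 + q + 3) * 39 + 38 * 4 + (10 + 9 * q) ≡ 12 * (31 + q) * 4
          ring₂ = solve-∀
          ring₃ : ∀ r T → (r + T * 39) * 4 ≡ T * 2 * 2 * 39 + r * 4
          ring₃ = solve-∀

  ring₁ : ∀ p → p + (p + 3) ≡ suc (p * 2 + 2)
  ring₁ = solve-∀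

-- The counting bound p + 2 < 4⌊12p/39⌋ fails for p = 5, 11, 19.
SmallPrimeWitness : ℕ → ℕ → Set
SmallPrimeWitness p r =
  ∃₂ λ (t : Fin (12 * p / 39)) (w : Fin p) → + p ℤ.∣ conic (+ r ℤ.* + suc (toℕ t)) (+ toℕ w)

small-prime-table : ∀ (p : Fin 31) (r : Fin (toℕ p)) → Prime (toℕ p) → 5 ≤ toℕ p → toℕ p ≢ 7 →
                    0 < toℕ r → SmallPrimeWitness (toℕ p) (toℕ r)
small-prime-table = from-yes (all? {n = 31} λ p → all? {n = toℕ p} λ r →
  prime? (toℕ p) →-dec 5 ≤? toℕ p →-dec ¬? (toℕ p ≟ 7) →-dec 0 <? toℕ r →-dec witness? (toℕ p) (toℕ r))
  where
  witness? : ∀ p r → Dec (SmallPrimeWitness p r)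
  witness? p r = any? λ t → any? λ w → + p ℤ.∣? conic (+ r ℤ.* + suc (toℕ t)) (+ toℕ w)

small-prime-witness : ∀ {p r} → p < 31 → r < p → Prime p → 5 ≤ p → p ≢ 7 → 0 < r → SmallPrimeWitness p r
small-prime-witness p<31 r<p with fromℕ< p<31 | Fin.toℕ-fromℕ< p<31
... | p′ | refl with fromℕ< r<p | Fin.toℕ-fromℕ< r<p
...   | r′ | refl = small-prime-table p′ r′

multiple-on-conic : ∀ {p h δ} (p-prime : Prime p) → p ≡ suc (h + h) → 5 ≤ p → p ≢ 7 → p ∤ δ →
                    let open Modular p p-prime in
                    ∃₂ λ (t : Fin (12 * p / 39)) w → conic (+ δ ℤ.* + suc (toℕ t)) w ≈ ℤ.0ℤ
multiple-on-conic {p} {h} {δ} p-prime p≡2h+1 5≤p p≢7 p∤δ = cases (p <? 31)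
  where
  open Modular p p-prime
  open OddPrime p h p-prime p≡2h+1 5≤p
  open import Relation.Binary.Reasoning.Setoid ≈-setoid

  δ≉0 : + δ ≉ ℤ.0ℤ
  δ≉0 = p∤δ ∘ ≈0⇒p∣ℕ

  r = toℕ (residue (+ δ))

  0<r : 0 < r
  0<r = ℕ.n≢0⇒n>0 (≉0⇒residue≢0 δ≉0)

  cases : Dec (p < 31) → ∃₂ λ (t : Fin (12 * p / 39)) w → conic (+ δ ℤ.* + suc (toℕ t)) w ≈ ℤ.0ℤ
  cases (no p≮31) = Counting.enough-candidates⇒multiple-on-conic δ≉0 (⌊12p/39⌋≤h p≡2h+1)
                      (room-for-large-primes (ℕ.≮⇒≥ p≮31))
  cases (yes p<31) with t , w , p∣ ← small-prime-witness p<31 (Fin.toℕ<n (residue (+ δ))) p-prime 5≤p p≢7 0<r =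
    t , + toℕ w , (begin
      conic (+ δ ℤ.* + suc (toℕ t)) (+ toℕ w)  ≈⟨ conic-cong (*-cong (≈residue (+ δ)) (≈-refl {+ suc (toℕ t)}))
                                                               (≈-refl {+ toℕ w}) ⟩
      conic (+ r ℤ.* + suc (toℕ t)) (+ toℕ w)  ≈⟨ p∣⇒≈0 p∣ ⟩
      ℤ.0ℤ                                      ∎)

cubicFactor : ℕ → ℕ → ℕ
cubicFactor a d = 3 * (a * (a + d)) + d * d + 1

+cubicFactor : ∀ a d → + cubicFactor a d ≡ + 3 ℤ.* (+ a ℤ.* (+ a ℤ.+ + d)) ℤ.+ + d ℤ.* + d ℤ.+ ℤ.1ℤ
+cubicFactor a d = cong₂ (λ x y → x ℤ.+ y ℤ.+ ℤ.1ℤ)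
  (trans (ℤ.pos-* 3 (a * (a + d))) (cong (ℤ._*_ (+ 3)) (ℤ.pos-* a (a + d)))) (ℤ.pos-* d d)

cube-shift : ∀ a d → (a + d) ^ 3 + (a + d) ≡ a ^ 3 + a + d * cubicFactor a d
cube-shift = ring
  where ring : ∀ a d → (a + d) * ((a + d) * ((a + d) * 1)) + (a + d)
                     ≡ a * (a * (a * 1)) + a + d * (3 * (a * (a + d)) + d * d + 1)
        ring = solve-∀

cubic-factor-root-at-multiple : ∀ {p δ} → Prime p → 5 ≤ p → p ≢ 7 → p ∤ δ →
  ∃[ t ] 1 ≤ t × 39 * t ≤ 12 * p × ∃[ a ] 1 ≤ a × a ≤ p × p ∣ cubicFactor a (δ * t)
cubic-factor-root-at-multiple {p} {δ} p-prime 5≤p p≢7 p∤δ =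
  let h , p≡2h+1 = prime⇒odd p-prime (ℕ.≤-trans (s≤s (s≤s (s≤s z≤n))) 5≤p)
      t , w , on = multiple-on-conic {h = h} p-prime p≡2h+1 5≤p p≢7 p∤δ
      d = δ * suc (toℕ t)
      a , 1≤a , a≤p , factor≈0 = OddPrime.cubic-factor-root p h p-prime p≡2h+1 5≤p (+ d) w
                                   (subst (λ d → conic d w ≈ ℤ.0ℤ) (sym (ℤ.pos-* δ (suc (toℕ t)))) on)
  in suc (toℕ t) , s≤s z≤n , ≤⌊12p/39⌋⇒39*≤12p {p} (Fin.toℕ<n t) ,
     a , 1≤a , a≤p , ≈0⇒p∣ℕ (subst (_≈ ℤ.0ℤ) (sym (+cubicFactor a d)) factor≈0)
  where open Modular p p-prime

≡[mod]-shift : ∀ {m} y z → m ∣ z → (y + z) ≡ y [mod m ]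
≡[mod]-shift {m} y z m∣z = subst (λ i → m ∣ ℤ.∣ i ∣) (sym +[y+z]-+y≡+z) m∣z
  where +[y+z]-+y≡+z : + (y + z) ℤ.- + y ≡ + z
        +[y+z]-+y≡+z = trans (ℤ.m-n≡m⊖n (y + z) y) (trans (ℤ.⊖-≥ (ℕ.m≤m+n y z)) (cong +_ (ℕ.m+n∸m≡n y z)))

3*[p+δt]≤δp : ∀ {p δ t} → 39 ≤ δ → 39 * t ≤ 12 * p → 3 * (p + δ * t) ≤ δ * p
3*[p+δt]≤δp {p} {δ} {t} 39≤δ 39t≤12p = ℕ.*-cancelˡ-≤ 13 (begin
  13 * (3 * (p + δ * t))  ≡⟨ ring₁ p δ t ⟩
  39 * p + δ * (39 * t)   ≤⟨ ℕ.+-mono-≤ (ℕ.*-monoˡ-≤ p 39≤δ) (ℕ.*-monoʳ-≤ δ 39t≤12p) ⟩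
  δ * p + δ * (12 * p)    ≡⟨ ring₂ p δ ⟩
  13 * (δ * p)            ∎)
  where
  open ℕ.≤-Reasoning
  ring₁ : ∀ p δ t → 13 * (3 * (p + δ * t)) ≡ 39 * p + δ * (39 * t)
  ring₁ = solve-∀
  ring₂ : ∀ p δ → δ * p + δ * (12 * p) ≡ 13 * (δ * p)
  ring₂ = solve-∀

lemma3p4 : (n k m δ p : ℕ) → 1 ≤ n → IsCeilLog3 n k → n ≤ m → m < 3 ^ k → 3 ^ k < 3 * n → m ≡ δ * p → δ ≥ 39 → Prime p → p ≥ 5 → p ≢ 7 → p ∤ δ → ∃[ a ] ∃[ b ] (1 ≤ a × a < b × b ≤ n × (b ^ 3 + b) ≡ (a ^ 3 + a) [mod m ])
lemma3p4 n k m δ p _ _ _ m<3ᵏ 3ᵏ<3n m≡δp δ≥39 p-prime p≥5 p≢7 p∤δ =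
  let t , 1≤t , 39t≤12p , a , 1≤a , a≤p , p∣factor = cubic-factor-root-at-multiple p-prime p≥5 p≢7 p∤δ
      open ℕ.≤-Reasoning
      m∣shift : m ∣ δ * t * cubicFactor a (δ * t)
      m∣shift = subst₂ _∣_ (sym m≡δp) (sym (ℕ.*-assoc δ t _)) (*-monoʳ-∣ δ (∣n⇒∣m*n t p∣factor))
  in a , a + δ * t , 1≤a ,
     ℕ.m<m+n a (ℕ.*-mono-≤ (ℕ.≤-trans (s≤s z≤n) δ≥39) 1≤t) ,
     ℕ.<⇒≤ (ℕ.*-cancelˡ-< 3 _ _ (begin-strict
       3 * (a + δ * t)  ≤⟨ ℕ.*-monoʳ-≤ 3 (ℕ.+-monoˡ-≤ (δ * t) a≤p) ⟩
       3 * (p + δ * t)  ≤⟨ 3*[p+δt]≤δp δ≥39 39t≤12p ⟩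
       δ * p            ≡⟨ m≡δp ⟨
       m                <⟨ m<3ᵏ ⟩
       3 ^ k            <⟨ 3ᵏ<3n ⟩
       3 * n            ∎)) ,
     subst (_≡ (a ^ 3 + a) [mod m ]) (sym (cube-shift a (δ * t))) (≡[mod]-shift (a ^ 3 + a) _ m∣shift)
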